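{- Let $n,t\ge 2$ and $2\le p<n$ be integers. Let $P\in\mathbb{Q}^{p\times n}$ and $Q\in\mathbb{Q}^{n\times p}$ both have rank $p$, with $W_0=PQ\in\mathbb{Q}^{p\times p}$ of full rank (hence invertible), let $U_1,\dots,U_t\in\mathbb{Q}^{n\times n}$ be diagonal, and $W_a=PU_aQ$ for $a\in[t]$. For $1\le a,b\le t$ let $\Delta_{ab}=W_aW_0^{ -1}W_b-W_bW_0^{ -1}W_a$. Let $B=QW_0^{ -1}P-1_n\in\mathbb{Q}^{n\times n}$ and let $r$ be its rank. Then (i) $r=n-p$; and (ii) there exist matrices $V_a\in\mathbb{Q}^{p\times r}$ and $G_a\in\mathbb{Q}^{r\times p}$ for $a\in[t]$ such that $\Delta_{ab}=V_aG_b-V_bG_a$ for all $1\le a<b\le t$.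
   Context: $[t]=\{1,\dots,t\}$; $1_n$ is the $n\times n$ identity matrix. -}

module Defs where

open import Data.Nat using (ℕ; zero; suc)
open import Data.Fin using (Fin; zero; suc)
open import Data.Rational using (ℚ; 0ℚ; 1ℚ; _+_; _*_; _-_)
open import Data.Product using (Σ; ∃; _×_)
open import Relation.Binary.PropositionalEquality using (_≡_; _≢_)
open import Relation.Nullary using (¬_)

Matrix : ℕ → ℕ → Set
Matrix m n = Fin m → Fin n → ℚ

Σ[<_] : (k : ℕ) → (Fin k → ℚ) → ℚ
Σ[< zero ] f = 0ℚ
Σ[< suc k ] f = f zero + Σ[< k ] (λ i → f (suc i))

infixl 7 _⊗_
_⊗_ : ∀ {m k n} → Matrix m k → Matrix k n → Matrix m n
(A ⊗ B) i j = Σ[< _ ] (λ l → A i l * B l j)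

infixl 6 _⊖_
_⊖_ : ∀ {m n} → Matrix m n → Matrix m n → Matrix m n
(A ⊖ B) i j = A i j - B i j

idM : ∀ n → Matrix n n
idM n i j with i Data.Fin.≟ j
... | Relation.Nullary.yes _ = 1ℚ
... | Relation.Nullary.no _ = 0ℚ

IsDiagonal : ∀ {n} → Matrix n n → Set
IsDiagonal {n} U = ∀ (i j : Fin n) → i ≢ j → U i j ≡ 0ℚ

LinIndep : ∀ {m k} → (Fin k → Fin m → ℚ) → Set
LinIndep {m} {k} v =
  ∀ (c : Fin k → ℚ) → (∀ (i : Fin m) → Σ[< k ] (λ j → c j * v j i) ≡ 0ℚ) →
  ∀ (j : Fin k) → c j ≡ 0ℚ

col : ∀ {m n} → Matrix m n → Fin n → Fin m → ℚ
col A j i = A i j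

HasRank : ∀ {m n} → Matrix m n → ℕ → Set
HasRank {m} {n} A r =
  (Σ (Fin r → Fin n) λ s → LinIndep (λ j → col A (s j))) ×
  (∀ (s : Fin (suc r) → Fin n) → ¬ LinIndep (λ j → col A (s j)))

-- matrix equality (entrywise; function extensionality is unavailable)
infix 4 _≐_
_≐_ : ∀ {m n} → Matrix m n → Matrix m n → Set
_≐_ {m} {n} A B = ∀ (i : Fin m) (j : Fin n) → A i j ≡ B i j

module Submission where

-- Put E = Q W₀⁻¹ and B = E P − 1, so that P E = 1 and hence P B = 0. Independent columns
-- of B are killed by P while P inverts E on the left, so r of them together with the p
-- columns of E are still independent: r + p ≤ n. A rank-r matrix factors as B = C D
-- through ℚʳ, and then 1 = E P − C D factors 1ₙ through ℚ^(r+p): n ≤ r + p.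
-- Finally Wₐ W₀⁻¹ W_b = P Uₐ (B + 1) U_b Q = (P Uₐ C)(D U_b Q) + P Uₐ U_b Q, and the last
-- term is symmetric in a and b because diagonal matrices commute.

open import Defs
open import Data.Nat as ℕ using (ℕ; zero; suc; _≤_; _<_; _∸_; z≤n; s≤s)
open import Data.Nat.Properties as ℕ using ()
open import Data.Fin using (Fin; zero; suc; _≟_; _↑ˡ_; _↑ʳ_; splitAt; join; punchIn; punchOut)
open import Data.Fin.Properties using (suc-injective; punchIn-punchOut; join-splitAt; all?; ¬∀⟶∃¬)
open import Data.Vec.Functional using (_∷_; _++_)
open import Data.Vec.Functional.Properties using (lookup-++ˡ; lookup-++ʳ)
open import Data.Product using (Σ; _×_; _,_; proj₁; proj₂)
open import Data.Sum using (inj₁; inj₂)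
open import Data.Empty using (⊥-elim)
open import Function using (_∘_)
open import Relation.Nullary using (¬_; Dec; yes; no)
open import Relation.Binary.PropositionalEquality
open import Relation.Binary.Bundles using (Setoid)
import Relation.Binary.Reasoning.Setoid as SetoidReasoning
open import Level using (0ℓ)
open import Data.Rational as ℚ using (ℚ; 0ℚ; 1ℚ; _+_; _*_; _-_; -_; 1/_)
open import Data.Rational.Properties as ℚ using ()
open import Data.Rational.Solver
open +-*-Solver using (solve; _:=_; _:+_; _:-_; _:*_; :-_; con)

-- Finite sums

Σ-cong : ∀ {k} {f g : Fin k → ℚ} → (∀ i → f i ≡ g i) → Σ[< k ] f ≡ Σ[< k ] g
Σ-cong {zero}  f≗g = refl
Σ-cong {suc k} f≗g = cong₂ _+_ (f≗g zero) (Σ-cong (f≗g ∘ suc))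

Σ-zero : ∀ {k} {f : Fin k → ℚ} → (∀ i → f i ≡ 0ℚ) → Σ[< k ] f ≡ 0ℚ
Σ-zero {zero}  f≗0 = refl
Σ-zero {suc k} f≗0 = cong₂ _+_ (f≗0 zero) (Σ-zero (f≗0 ∘ suc))

Σ-distrib-+ : ∀ {k} (f g : Fin k → ℚ) →
  Σ[< k ] (λ i → f i + g i) ≡ Σ[< k ] f + Σ[< k ] g
Σ-distrib-+ {zero}  f g = refl
Σ-distrib-+ {suc k} f g = begin
  (f zero + g zero) + Σ[< k ] (λ i → f (suc i) + g (suc i))
    ≡⟨ cong ((f zero + g zero) +_) (Σ-distrib-+ (f ∘ suc) (g ∘ suc)) ⟩
  (f zero + g zero) + (Σ[< k ] (f ∘ suc) + Σ[< k ] (g ∘ suc))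
    ≡⟨ solve 4 (λ a b c d → (a :+ b) :+ (c :+ d) := (a :+ c) :+ (b :+ d)) refl (f zero) (g zero) _ _ ⟩
  (f zero + Σ[< k ] (f ∘ suc)) + (g zero + Σ[< k ] (g ∘ suc)) ∎
  where open ≡-Reasoning

*-distribˡ-Σ : ∀ {k} (c : ℚ) (f : Fin k → ℚ) → c * Σ[< k ] f ≡ Σ[< k ] (λ i → c * f i)
*-distribˡ-Σ {zero}  c f = ℚ.*-zeroʳ c
*-distribˡ-Σ {suc k} c f =
  trans (ℚ.*-distribˡ-+ c (f zero) _) (cong (c * f zero +_) (*-distribˡ-Σ c (f ∘ suc)))

*-distribʳ-Σ : ∀ {k} (c : ℚ) (f : Fin k → ℚ) → Σ[< k ] f * c ≡ Σ[< k ] (λ i → f i * c)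
*-distribʳ-Σ c f =
  trans (ℚ.*-comm _ c) (trans (*-distribˡ-Σ c f) (Σ-cong (λ i → ℚ.*-comm c (f i))))

neg-distrib-Σ : ∀ {k} (f : Fin k → ℚ) → - Σ[< k ] f ≡ Σ[< k ] (λ i → - f i)
neg-distrib-Σ {zero}  f = refl
neg-distrib-Σ {suc k} f =
  trans (ℚ.neg-distrib-+ (f zero) _) (cong (- f zero +_) (neg-distrib-Σ (f ∘ suc)))

Σ-distrib‿- : ∀ {k} (f g : Fin k → ℚ) →
  Σ[< k ] (λ i → f i - g i) ≡ Σ[< k ] f - Σ[< k ] g
Σ-distrib‿- f g =
  trans (Σ-distrib-+ f (λ i → - g i)) (cong (Σ[< _ ] f +_) (sym (neg-distrib-Σ g)))

Σ-comm : ∀ {k m} (f : Fin k → Fin m → ℚ) →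
  Σ[< k ] (λ i → Σ[< m ] (f i)) ≡ Σ[< m ] (λ j → Σ[< k ] (λ i → f i j))
Σ-comm {zero} {m} f = sym (Σ-zero {m} (λ _ → refl))
Σ-comm {suc k} {m} f =
  trans (cong (Σ[< m ] (f zero) +_) (Σ-comm (f ∘ suc)))
        (sym (Σ-distrib-+ (f zero) (λ j → Σ[< k ] (λ i → f (suc i) j))))

Σ-++ : ∀ m {n} (f : Fin (m ℕ.+ n) → ℚ) →
  Σ[< m ℕ.+ n ] f ≡ Σ[< m ] (λ i → f (i ↑ˡ n)) + Σ[< n ] (λ j → f (m ↑ʳ j))
Σ-++ zero    f = sym (ℚ.+-identityˡ _)
Σ-++ (suc m) f =
  trans (cong (f zero +_) (Σ-++ m (f ∘ suc))) (sym (ℚ.+-assoc (f zero) _ _))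

Σ-single : ∀ {k} (f : Fin k → ℚ) (i : Fin k) → (∀ j → j ≢ i → f j ≡ 0ℚ) → Σ[< k ] f ≡ f i
Σ-single f zero    f≗0 =
  trans (cong (f zero +_) (Σ-zero (λ j → f≗0 (suc j) (λ ())))) (ℚ.+-identityʳ _)
Σ-single f (suc i) f≗0 =
  trans (cong₂ _+_ (f≗0 zero (λ ()))
                   (Σ-single (f ∘ suc) i (λ j j≢i → f≗0 (suc j) (j≢i ∘ suc-injective))))
        (ℚ.+-identityˡ _)

idM-diagonal : ∀ n (i : Fin n) → idM n i i ≡ 1ℚ
idM-diagonal n i with i ≟ i
... | yes _  = refl
... | no i≢i = ⊥-elim (i≢i refl)

idM-offDiagonal : ∀ n (i j : Fin n) → i ≢ j → idM n i j ≡ 0ℚ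
idM-offDiagonal n i j i≢j with i ≟ j
... | yes i≡j = ⊥-elim (i≢j i≡j)
... | no _    = refl

Σ-idMʳ : ∀ {k} (f : Fin k → ℚ) (i : Fin k) → Σ[< k ] (λ j → f j * idM k j i) ≡ f i
Σ-idMʳ {k} f i = trans
  (Σ-single _ i (λ j j≢i → trans (cong (f j *_) (idM-offDiagonal k j i j≢i)) (ℚ.*-zeroʳ (f j))))
  (trans (cong (f i *_) (idM-diagonal k i)) (ℚ.*-identityʳ (f i)))

Σ-idMˡ : ∀ {k} (f : Fin k → ℚ) (i : Fin k) → Σ[< k ] (λ j → f j * idM k i j) ≡ f i
Σ-idMˡ {k} f i = trans (Σ-cong (λ j → cong (f j *_) (idM-sym k i j))) (Σ-idMʳ f i)
  where
  idM-sym : ∀ n (i j : Fin n) → idM n i j ≡ idM n j i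
  idM-sym n i j = by-cases (i ≟ j)
    where
    by-cases : Dec (i ≡ j) → idM n i j ≡ idM n j i
    by-cases (yes refl) = refl
    by-cases (no i≢j)   = trans (idM-offDiagonal n i j i≢j) (sym (idM-offDiagonal n j i (i≢j ∘ sym)))

idM-suc : ∀ k (a b : Fin k) → idM (suc k) (suc a) (suc b) ≡ idM k a b
idM-suc k a b = by-cases (a ≟ b)
  where
  by-cases : Dec (a ≡ b) → idM (suc k) (suc a) (suc b) ≡ idM k a b
  by-cases (yes refl) = trans (idM-diagonal (suc k) (suc a)) (sym (idM-diagonal k a))
  by-cases (no a≢b)   =
    trans (idM-offDiagonal (suc k) (suc a) (suc b) (a≢b ∘ suc-injective))
          (sym (idM-offDiagonal k a b a≢b))

1≢0 : 1ℚ ≢ 0ℚ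
1≢0 ()

-- Linear independence

infix 7 _·_
_·_ : ∀ {N} → (Fin N → ℚ) → (Fin N → ℚ) → ℚ
x · y = Σ[< _ ] (λ i → x i * y i)

lincomb : ∀ {N k} → (Fin k → ℚ) → (Fin k → Fin N → ℚ) → Fin N → ℚ
lincomb c v i = Σ[< _ ] (λ j → c j * v j i)

·-comm : ∀ {N} (x y : Fin N → ℚ) → x · y ≡ y · x
·-comm x y = Σ-cong (λ i → ℚ.*-comm (x i) (y i))

idM-· : ∀ {N} (i : Fin N) (x : Fin N → ℚ) → idM N i · x ≡ x i
idM-· i x = trans (·-comm (idM _ i) x) (Σ-idMˡ x i)

·-lincomb : ∀ {N k} (x : Fin N → ℚ) (c : Fin k → ℚ) (v : Fin k → Fin N → ℚ) →
  x · lincomb c v ≡ Σ[< k ] (λ j → c j * (x · v j))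
·-lincomb {N} {k} x c v = begin
  Σ[< N ] (λ i → x i * Σ[< k ] (λ j → c j * v j i))
    ≡⟨ Σ-cong (λ i → *-distribˡ-Σ {k} (x i) _) ⟩
  Σ[< N ] (λ i → Σ[< k ] (λ j → x i * (c j * v j i)))
    ≡⟨ Σ-comm (λ i j → x i * (c j * v j i)) ⟩
  Σ[< k ] (λ j → Σ[< N ] (λ i → x i * (c j * v j i)))
    ≡⟨ Σ-cong (λ j → trans (Σ-cong {N} (λ i → solve 3 (λ x c v → x :* (c :* v) := c :* (x :* v))
                                                        refl (x i) (c j) (v j i)))
                           (sym (*-distribˡ-Σ {N} (c j) _))) ⟩
  Σ[< k ] (λ j → c j * (x · v j)) ∎
  where open ≡-Reasoning

·-distribˡ-+ : ∀ {N} (x y z : Fin N → ℚ) → x · (λ i → y i + z i) ≡ x · y + x · z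
·-distribˡ-+ x y z = trans (Σ-cong (λ i → ℚ.*-distribˡ-+ (x i) (y i) (z i)))
                            (Σ-distrib-+ (λ i → x i * y i) (λ i → x i * z i))

lincomb-· : ∀ {N k} (c : Fin k → ℚ) (v : Fin k → Fin N → ℚ) (x : Fin N → ℚ) →
  lincomb c v · x ≡ Σ[< k ] (λ j → c j * (v j · x))
lincomb-· c v x =
  trans (·-comm (lincomb c v) x) (trans (·-lincomb x c v) (Σ-cong (λ j → cong (c j *_) (·-comm x (v j)))))

lincomb-++ : ∀ {N m n} (c : Fin (m ℕ.+ n) → ℚ) (v : Fin m → Fin N → ℚ) (w : Fin n → Fin N → ℚ)
  i →   lincomb c (v ++ w) i ≡ lincomb (λ j → c (j ↑ˡ n)) v i + lincomb (λ j → c (m ↑ʳ j)) w i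
lincomb-++ {m = m} c v w i = trans (Σ-++ m _) (cong₂ _+_
  (Σ-cong (λ j → cong (λ u → c (j ↑ˡ _) * u i) (lookup-++ˡ v w j)))
  (Σ-cong (λ j → cong (λ u → c (m ↑ʳ j) * u i) (lookup-++ʳ v w j))))

IsLeftInverse : ∀ {N k} → (Fin k → Fin N → ℚ) → (Fin k → Fin N → ℚ) → Set
IsLeftInverse {k = k} L v = ∀ a b → L a · v b ≡ idM k a b

nonzero-entry : ∀ {N} (x : Fin N → ℚ) → ¬ (∀ i → x i ≡ 0ℚ) → Σ (Fin N) λ i → x i ≢ 0ℚ
nonzero-entry {N} x x≢0 = ¬∀⟶∃¬ N _ (λ i → x i ℚ.≟ 0ℚ) x≢0

LinIndep-tail : ∀ {N k} (v : Fin (suc k) → Fin N → ℚ) → LinIndep v → LinIndep (v ∘ suc)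
LinIndep-tail v ind c vc≡0 j = ind (0ℚ ∷ c) (λ i →
  trans (cong (_+ lincomb c (v ∘ suc) i) (ℚ.*-zeroˡ (v zero i))) (trans (ℚ.+-identityˡ _) (vc≡0 i))) (suc j)

module LeftInverseStep {N k} (v : Fin (suc k) → Fin N → ℚ) (L : Fin k → Fin N → ℚ)
                       (L-inv : IsLeftInverse L (v ∘ suc)) where

  open ≡-Reasoning

  d : Fin k → ℚ
  d a = L a · v zero

  residual : Fin N → ℚ
  residual i = v zero i - lincomb d (v ∘ suc) i

  LinIndep⇒residual≢0 : LinIndep v → ¬ (∀ i → residual i ≡ 0ℚ)
  LinIndep⇒residual≢0 ind residual≡0 =
    1≢0 (ind (1ℚ ∷ λ a → - d a) (λ i → trans (eq i) (residual≡0 i)) zero)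
    where
    eq : ∀ i → lincomb (1ℚ ∷ λ a → - d a) v i ≡ residual i
    eq i = cong₂ _+_ (ℚ.*-identityˡ (v zero i))
      (trans (Σ-cong (λ a → sym (ℚ.neg-distribˡ-* (d a) (v (suc a) i))))
             (sym (neg-distrib-Σ (λ a → d a * v (suc a) i))))

  module Extend (i₀ : Fin N) (residual≢0 : residual i₀ ≢ 0ℚ) where

    instance
      residual-nonZero : ℚ.NonZero (residual i₀)
      residual-nonZero = ℚ.≢-nonZero residual≢0

    ν : ℚ
    ν = 1/ residual i₀

    -- φ kills the tail of v (there L is a left inverse) and is 1 on v zero by the choice of ν.
    φ : Fin N → ℚ
    φ i = ν * (idM N i₀ i - lincomb (λ a → v (suc a) i₀) L i)

    φ-· : ∀ x → φ · x ≡ ν * (x i₀ - Σ[< k ] (λ a → v (suc a) i₀ * (L a · x)))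
    φ-· x = begin
      φ · x
        ≡⟨ Σ-cong (λ i → solve 4 (λ n e l x → (n :* (e :- l)) :* x := n :* (e :* x :- l :* x))
                                  refl ν (idM N i₀ i) (lincomb (λ a → v (suc a) i₀) L i) (x i)) ⟩
      Σ[< N ] (λ i → ν * (idM N i₀ i * x i - lincomb (λ a → v (suc a) i₀) L i * x i))
        ≡⟨ sym (*-distribˡ-Σ {N} ν _) ⟩
      ν * Σ[< N ] (λ i → idM N i₀ i * x i - lincomb (λ a → v (suc a) i₀) L i * x i)
        ≡⟨ cong (ν *_) (Σ-distrib‿- {N} _ _) ⟩
      ν * (idM N i₀ · x - lincomb (λ a → v (suc a) i₀) L · x)
        ≡⟨ cong₂ (λ s t → ν * (s - t)) (idM-· i₀ x) (lincomb-· (λ a → v (suc a) i₀) L x) ⟩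
      ν * (x i₀ - Σ[< k ] (λ a → v (suc a) i₀ * (L a · x))) ∎

    φ-·-head : φ · v zero ≡ 1ℚ
    φ-·-head = trans (φ-· (v zero))
      (trans (cong (λ t → ν * (v zero i₀ - t)) (Σ-cong (λ a → ℚ.*-comm (v (suc a) i₀) (d a))))
             (ℚ.*-inverseˡ (residual i₀)))

    φ-·-tail : ∀ b → φ · v (suc b) ≡ 0ℚ
    φ-·-tail b = trans (φ-· (v (suc b)))
      (trans (cong (λ t → ν * (v (suc b) i₀ - t))
                   (trans (Σ-cong (λ a → cong (v (suc a) i₀ *_) (L-inv a b)))
                          (Σ-idMʳ (λ a → v (suc a) i₀) b)))
             (solve 2 (λ n x → n :* (x :- x) := con 0ℚ) refl ν (v (suc b) i₀)))

    L⁺ : Fin (suc k) → Fin N → ℚ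
    L⁺ zero      = φ
    L⁺ (suc a) i = L a i - d a * φ i

    L⁺-suc-· : ∀ a x → L⁺ (suc a) · x ≡ L a · x - d a * (φ · x)
    L⁺-suc-· a x = trans
      (Σ-cong (λ i → solve 4 (λ l d f x → (l :- d :* f) :* x := l :* x :- d :* (f :* x))
                             refl (L a i) (d a) (φ i) (x i)))
      (trans (Σ-distrib‿- {N} _ _) (cong (λ t → L a · x - t) (sym (*-distribˡ-Σ {N} (d a) _))))

    L⁺-inv : IsLeftInverse L⁺ v
    L⁺-inv zero    zero    = trans φ-·-head (sym (idM-diagonal (suc k) zero))
    L⁺-inv zero    (suc b) = trans (φ-·-tail b) (sym (idM-offDiagonal (suc k) zero (suc b) (λ ())))
    L⁺-inv (suc a) zero    = trans (L⁺-suc-· a (v zero))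
      (trans (cong (λ t → d a - d a * t) φ-·-head)
      (trans (solve 1 (λ x → x :- x :* con 1ℚ := con 0ℚ) refl (d a))
             (sym (idM-offDiagonal (suc k) (suc a) zero (λ ())))))
    L⁺-inv (suc a) (suc b) = trans (L⁺-suc-· a (v (suc b)))
      (trans (cong₂ (λ s t → s - d a * t) (L-inv a b) (φ-·-tail b))
      (trans (solve 2 (λ s x → s :- x :* con 0ℚ := s) refl (idM k a b) (d a))
             (sym (idM-suc k a b))))

  extend : LinIndep v → Σ (Fin (suc k) → Fin N → ℚ) λ L⁺ → IsLeftInverse L⁺ v
  extend ind with nonzero-entry residual (LinIndep⇒residual≢0 ind)
  ... | i₀ , residual≢0 = Extend.L⁺ i₀ residual≢0 , Extend.L⁺-inv i₀ residual≢0

LinIndep⇒leftInverse : ∀ {N} k (v : Fin k → Fin N → ℚ) → LinIndep v →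
  Σ (Fin k → Fin N → ℚ) λ L → IsLeftInverse L v
LinIndep⇒leftInverse zero    v ind = (λ ()) , (λ ())
LinIndep⇒leftInverse (suc k) v ind with LinIndep⇒leftInverse k (v ∘ suc) (LinIndep-tail v ind)
... | L , L-inv = LeftInverseStep.extend v L L-inv ind

LinIndep-head≢0 : ∀ {N k} (v : Fin (suc k) → Fin N → ℚ) → LinIndep v → ¬ (∀ i → v zero i ≡ 0ℚ)
LinIndep-head≢0 v ind head≡0 = 1≢0 (ind (1ℚ ∷ λ _ → 0ℚ) (λ i → cong₂ _+_
  (trans (ℚ.*-identityˡ (v zero i)) (head≡0 i)) (Σ-zero (λ j → ℚ.*-zeroˡ (v (suc j) i)))) zero)

-- Subtracting multiples of v zero clears the pivot coordinate i₀ of the other vectors, which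
-- stay independent after dropping that coordinate.
module EliminationStep {N k} (v : Fin (suc k) → Fin (suc N) → ℚ) (i₀ : Fin (suc N))
                       (pivot≢0 : v zero i₀ ≢ 0ℚ) where

  open ≡-Reasoning

  instance
    pivot-nonZero : ℚ.NonZero (v zero i₀)
    pivot-nonZero = ℚ.≢-nonZero pivot≢0

  ratio : Fin k → ℚ
  ratio j = v (suc j) i₀ * 1/ v zero i₀

  reduced : Fin k → Fin (suc N) → ℚ
  reduced j i = v (suc j) i - ratio j * v zero i

  reduced-pivot : ∀ j → reduced j i₀ ≡ 0ℚ
  reduced-pivot j = begin
    x - x * ν * p   ≡⟨ cong (λ t → x - t) (ℚ.*-assoc x ν p) ⟩
    x - x * (ν * p) ≡⟨ cong (λ t → x - x * t) (ℚ.*-inverseˡ p) ⟩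
    x - x * 1ℚ      ≡⟨ solve 1 (λ x → x :- x :* con 1ℚ := con 0ℚ) refl x ⟩
    0ℚ              ∎
    where
    x p ν : ℚ
    x = v (suc j) i₀
    p = v zero i₀
    ν = 1/ p

  lincomb-reduced : ∀ c i → lincomb c reduced i ≡ lincomb (- Σ[< k ] (λ j → c j * ratio j) ∷ c) v i
  lincomb-reduced c i = begin
    Σ[< k ] (λ j → c j * (v (suc j) i - ratio j * v zero i))
      ≡⟨ Σ-cong (λ j → solve 4 (λ c a r b → c :* (a :- r :* b) := c :* a :- (c :* r) :* b)
                                refl (c j) (v (suc j) i) (ratio j) (v zero i)) ⟩
    Σ[< k ] (λ j → c j * v (suc j) i - (c j * ratio j) * v zero i)
      ≡⟨ Σ-distrib‿- {k} _ _ ⟩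
    Σ[< k ] (λ j → c j * v (suc j) i) - Σ[< k ] (λ j → (c j * ratio j) * v zero i)
      ≡⟨ cong (λ t → Σ[< k ] (λ j → c j * v (suc j) i) - t) (sym (*-distribʳ-Σ {k} (v zero i) _)) ⟩
    Σ[< k ] (λ j → c j * v (suc j) i) - Σ[< k ] (λ j → c j * ratio j) * v zero i
      ≡⟨ solve 3 (λ s a b → s :- a :* b := (:- a) :* b :+ s) refl
                 (Σ[< k ] (λ j → c j * v (suc j) i)) (Σ[< k ] (λ j → c j * ratio j)) (v zero i) ⟩
    lincomb (- Σ[< k ] (λ j → c j * ratio j) ∷ c) v i ∎

  LinIndep-reduced : LinIndep v → LinIndep (λ j i → reduced j (punchIn i₀ i))
  LinIndep-reduced ind c reduced≡0 j =
    ind (- Σ[< k ] (λ j → c j * ratio j) ∷ c) (λ i → trans (sym (lincomb-reduced c i)) (everywhere i)) (suc j)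
    where
    everywhere : ∀ i → lincomb c reduced i ≡ 0ℚ
    everywhere i with i₀ ≟ i
    ... | yes refl = Σ-zero (λ j → trans (cong (c j *_) (reduced-pivot j)) (ℚ.*-zeroʳ (c j)))
    ... | no i₀≢i  =
      trans (cong (lincomb c reduced) (sym (punchIn-punchOut i₀≢i))) (reduced≡0 (punchOut i₀≢i))

LinIndep⇒≤ : ∀ {N} k (v : Fin k → Fin N → ℚ) → LinIndep v → k ≤ N
LinIndep⇒≤ zero v ind = z≤n
LinIndep⇒≤ (suc k) v ind with nonzero-entry (v zero) (LinIndep-head≢0 v ind)
LinIndep⇒≤ {suc N} (suc k) v ind | i₀ , pivot≢0 =
  s≤s (LinIndep⇒≤ k _ (EliminationStep.LinIndep-reduced v i₀ pivot≢0 ind))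

module Coordinates {N r} (v : Fin r → Fin N → ℚ) (L : Fin r → Fin N → ℚ) (L-inv : IsLeftInverse L v) where

  open ≡-Reasoning

  coordinates-lincomb : ∀ d l → L l · lincomb d v ≡ d l
  coordinates-lincomb d l =
    trans (·-lincomb (L l) d v) (trans (Σ-cong (λ m → cong (d m *_) (L-inv l m))) (Σ-idMˡ d l))

  LinIndep-∷ : ∀ x → LinIndep v → ¬ (∀ i → x i ≡ lincomb (λ l → L l · x) v i) → LinIndep (x ∷ v)
  LinIndep-∷ x ind x∉span c c≡0 with c zero ℚ.≟ 0ℚ
  ... | yes c₀≡0 = λ { zero → c₀≡0 ; (suc l) → ind (c ∘ suc) tail≡0 l }
    where
    tail≡0 : ∀ i → lincomb (c ∘ suc) v i ≡ 0ℚ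
    tail≡0 i = trans (sym (ℚ.+-identityˡ _))
      (trans (cong (_+ lincomb (c ∘ suc) v i) (sym (trans (cong (_* x i) c₀≡0) (ℚ.*-zeroˡ (x i)))))
             (c≡0 i))
  ... | no c₀≢0 = ⊥-elim (x∉span λ i →
          trans (x∈span i) (Σ-cong (λ l → cong (_* v l i) (sym (coordinates l)))))
    where
    instance
      c₀-nonZero : ℚ.NonZero (c zero)
      c₀-nonZero = ℚ.≢-nonZero c₀≢0

    κ : ℚ
    κ = 1/ c zero

    d : Fin r → ℚ
    d l = - (κ * c (suc l))

    x∈span : ∀ i → x i ≡ lincomb d v i
    x∈span i = sym (begin
      Σ[< r ] (λ l → - (κ * c (suc l)) * v l i)
        ≡⟨ Σ-cong (λ l → solve 3 (λ k c x → (:- (k :* c)) :* x := :- (k :* (c :* x)))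
                                  refl κ (c (suc l)) (v l i)) ⟩
      Σ[< r ] (λ l → - (κ * (c (suc l) * v l i)))
        ≡⟨ sym (neg-distrib-Σ {r} _) ⟩
      - Σ[< r ] (λ l → κ * (c (suc l) * v l i))
        ≡⟨ cong -_ (sym (*-distribˡ-Σ {r} κ _)) ⟩
      - (κ * S)
        ≡⟨ solve 4 (λ k c x s → :- (k :* s) := (k :* c) :* x :- k :* (c :* x :+ s)) refl κ (c zero) (x i) S ⟩
      (κ * c zero) * x i - κ * (c zero * x i + S)
        ≡⟨ cong₂ (λ s t → s * x i - κ * t) (ℚ.*-inverseˡ (c zero)) (c≡0 i) ⟩
      1ℚ * x i - κ * 0ℚ
        ≡⟨ solve 2 (λ x k → con 1ℚ :* x :- k :* con 0ℚ := x) refl (x i) κ ⟩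
      x i ∎)
      where
      S : ℚ
      S = lincomb (c ∘ suc) v i

    coordinates : ∀ l → L l · x ≡ d l
    coordinates l = trans (Σ-cong (λ i → cong (L l i *_) (x∈span i))) (coordinates-lincomb d l)

-- Maximality of the chosen columns is a negative statement and yields no coefficients; the
-- left inverse supplies the candidates D, and maximality only refutes that they fail.
HasRank⇒factorization : ∀ {m n r} (A : Matrix m n) → HasRank A r →
  Σ (Matrix m r) λ C → Σ (Matrix r n) λ D → A ≐ C ⊗ D
HasRank⇒factorization {m} {n} {r} A ((s , ind) , maximal)
  with LinIndep⇒leftInverse r (λ l → col A (s l)) ind
... | L , L-inv = C , D , A≐CD
  where
  C : Matrix m r
  C i l = A i (s l)

  D : Matrix r n
  D l j = L l · col A j

  A≐CD : A ≐ C ⊗ D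
  A≐CD i j with all? (λ i → A i j ℚ.≟ lincomb (λ l → D l j) (col C) i)
  ... | yes inSpan = trans (inSpan i) (Σ-cong (λ l → ℚ.*-comm (D l j) (C i l)))
  ... | no ¬inSpan = ⊥-elim (maximal (j ∷ s) (Coordinates.LinIndep-∷ (col C) L L-inv (col A j) ind ¬inSpan))

leftInverse⇒LinIndep : ∀ {N k} (L v : Fin k → Fin N → ℚ) → IsLeftInverse L v → LinIndep v
leftInverse⇒LinIndep {k = k} L v L-inv c c≡0 j = begin
  c j                                   ≡⟨ sym (Σ-idMˡ c j) ⟩
  Σ[< k ] (λ l → c l * idM k j l)       ≡⟨ Σ-cong (λ l → cong (c l *_) (sym (L-inv j l))) ⟩
  Σ[< k ] (λ l → c l * (L j · v l))     ≡⟨ sym (·-lincomb (L j) c v) ⟩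
  L j · lincomb c v                     ≡⟨ Σ-zero (λ i → trans (cong (L j i *_) (c≡0 i))
                                                                (ℚ.*-zeroʳ (L j i))) ⟩
  0ℚ                                    ∎
  where open ≡-Reasoning

LinIndep-++ : ∀ {N m n} (v : Fin m → Fin N → ℚ) (w π : Fin n → Fin N → ℚ) → LinIndep v →
  (∀ b l → π b · v l ≡ 0ℚ) → IsLeftInverse π w → LinIndep (v ++ w)
LinIndep-++ {N} {m} {n} v w π ind πv≡0 π-inv c c≡0 x = by-block (splitAt m x) (join-splitAt m n x)
  where
  open ≡-Reasoning

  cᵛ : Fin m → ℚ
  cᵛ l = c (l ↑ˡ n)

  cʷ : Fin n → ℚ
  cʷ b = c (m ↑ʳ b)

  cʷ≡0 : ∀ b → cʷ b ≡ 0ℚ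
  cʷ≡0 b = sym (begin
    0ℚ
      ≡⟨ sym (Σ-zero (λ i → trans (cong (π b i *_) (c≡0 i)) (ℚ.*-zeroʳ (π b i)))) ⟩
    π b · lincomb c (v ++ w)
      ≡⟨ trans (Σ-cong (λ i → cong (π b i *_) (lincomb-++ c v w i))) (·-distribˡ-+ (π b) _ _) ⟩
    π b · lincomb cᵛ v + π b · lincomb cʷ w
      ≡⟨ cong₂ _+_ (·-lincomb (π b) cᵛ v) (·-lincomb (π b) cʷ w) ⟩
    Σ[< m ] (λ l → cᵛ l * (π b · v l)) + Σ[< n ] (λ a → cʷ a * (π b · w a))
      ≡⟨ cong₂ _+_ (Σ-zero (λ l → trans (cong (cᵛ l *_) (πv≡0 b l)) (ℚ.*-zeroʳ (cᵛ l))))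
                   (Σ-cong (λ a → cong (cʷ a *_) (π-inv b a))) ⟩
    0ℚ + Σ[< n ] (λ a → cʷ a * idM n b a)
      ≡⟨ trans (ℚ.+-identityˡ _) (Σ-idMˡ cʷ b) ⟩
    cʷ b ∎)

  cᵛ≡0 : ∀ l → cᵛ l ≡ 0ℚ
  cᵛ≡0 = ind cᵛ (λ i → begin
    lincomb cᵛ v i                          ≡⟨ sym (ℚ.+-identityʳ _) ⟩
    lincomb cᵛ v i + 0ℚ                     ≡⟨ cong (lincomb cᵛ v i +_) (sym (Σ-zero (λ b →
                                                 trans (cong (_* w b i) (cʷ≡0 b)) (ℚ.*-zeroˡ (w b i))))) ⟩
    lincomb cᵛ v i + lincomb cʷ w i         ≡⟨ sym (lincomb-++ c v w i) ⟩
    lincomb c (v ++ w) i                    ≡⟨ c≡0 i ⟩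
    0ℚ                                      ∎)

  by-block : ∀ y → join m n y ≡ x → c x ≡ 0ℚ
  by-block (inj₁ l) refl = cᵛ≡0 l
  by-block (inj₂ b) refl = cʷ≡0 b

-- Matrices

infixl 6 _⊕_
_⊕_ : ∀ {m n} → Matrix m n → Matrix m n → Matrix m n
(A ⊕ B) i j = A i j + B i j

infixl 6 _∥_
_∥_ : ∀ {m k l} → Matrix m k → Matrix m l → Matrix m (k ℕ.+ l)
(A ∥ B) i = A i ++ B i

≐-setoid : ℕ → ℕ → Setoid 0ℓ 0ℓ
≐-setoid m n = record
  { Carrier       = Matrix m n
  ; _≈_           = _≐_
  ; isEquivalence = record
    { refl  = λ i j → refl
    ; sym   = λ A≐B i j → sym (A≐B i j)
    ; trans = λ A≐B B≐C i j → trans (A≐B i j) (B≐C i j)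
    }
  }

module ≐-Reasoning {m n : ℕ} = SetoidReasoning (≐-setoid m n)

≐-refl : ∀ {m n} {A : Matrix m n} → A ≐ A
≐-refl i j = refl

⊕-cong : ∀ {m n} {A A′ B B′ : Matrix m n} → A ≐ A′ → B ≐ B′ → A ⊕ B ≐ A′ ⊕ B′
⊕-cong A≐A′ B≐B′ i j = cong₂ _+_ (A≐A′ i j) (B≐B′ i j)

⊗-cong : ∀ {m k n} {A A′ : Matrix m k} {B B′ : Matrix k n} → A ≐ A′ → B ≐ B′ → A ⊗ B ≐ A′ ⊗ B′
⊗-cong A≐A′ B≐B′ i j = Σ-cong (λ l → cong₂ _*_ (A≐A′ i l) (B≐B′ l j))

⊗-congˡ : ∀ {m k n} (A : Matrix m k) {B B′ : Matrix k n} → B ≐ B′ → A ⊗ B ≐ A ⊗ B′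
⊗-congˡ A = ⊗-cong (≐-refl {A = A})

⊗-assoc : ∀ {m k l n} (A : Matrix m k) (B : Matrix k l) (C : Matrix l n) → (A ⊗ B) ⊗ C ≐ A ⊗ (B ⊗ C)
⊗-assoc {k = k} {l} A B C i j = begin
  Σ[< l ] (λ b → Σ[< k ] (λ a → A i a * B a b) * C b j)
    ≡⟨ Σ-cong (λ b → *-distribʳ-Σ (C b j) (λ a → A i a * B a b)) ⟩
  Σ[< l ] (λ b → Σ[< k ] (λ a → A i a * B a b * C b j))
    ≡⟨ Σ-comm (λ b a → A i a * B a b * C b j) ⟩
  Σ[< k ] (λ a → Σ[< l ] (λ b → A i a * B a b * C b j))
    ≡⟨ Σ-cong (λ a → trans (Σ-cong (λ b → ℚ.*-assoc (A i a) (B a b) (C b j)))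
                           (sym (*-distribˡ-Σ (A i a) (λ b → B a b * C b j)))) ⟩
  Σ[< k ] (λ a → A i a * Σ[< l ] (λ b → B a b * C b j)) ∎
  where open ≡-Reasoning

⊗-identityˡ : ∀ {m n} (A : Matrix m n) → idM m ⊗ A ≐ A
⊗-identityˡ {m} A i j = trans (Σ-cong (λ l → ℚ.*-comm (idM m i l) (A l j))) (Σ-idMˡ (λ l → A l j) i)

⊗-identityʳ : ∀ {m n} (A : Matrix m n) → A ⊗ idM n ≐ A
⊗-identityʳ A i j = Σ-idMʳ (A i) j

⊗-distribˡ-⊕ : ∀ {m k n} (A : Matrix m k) (B C : Matrix k n) → A ⊗ (B ⊕ C) ≐ A ⊗ B ⊕ A ⊗ C
⊗-distribˡ-⊕ A B C i j = ·-distribˡ-+ (A i) (λ l → B l j) (λ l → C l j)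

⊗-distribʳ-⊕ : ∀ {m k n} (A B : Matrix m k) (C : Matrix k n) → (A ⊕ B) ⊗ C ≐ A ⊗ C ⊕ B ⊗ C
⊗-distribʳ-⊕ A B C i j = trans (Σ-cong (λ l → ℚ.*-distribʳ-+ (C l j) (A i l) (B i l)))
                                (Σ-distrib-+ (λ l → A i l * C l j) (λ l → B i l * C l j))

∥-⊗-++ : ∀ {m k l n} (A : Matrix m k) (B : Matrix m l) (C : Matrix k n) (D : Matrix l n) →
  (A ∥ B) ⊗ (C ++ D) ≐ A ⊗ C ⊕ B ⊗ D
∥-⊗-++ {k = k} A B C D i j = trans (Σ-++ k _) (cong₂ _+_
  (Σ-cong (λ a → cong₂ (λ x y → x * y j) (lookup-++ˡ (A i) (B i) a) (lookup-++ˡ C D a)))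
  (Σ-cong (λ b → cong₂ (λ x y → x * y j) (lookup-++ʳ (A i) (B i) b) (lookup-++ʳ C D b))))

rank-complement : ∀ {n p r} (P : Matrix p n) (E : Matrix n p) → P ⊗ E ≐ idM p →
  HasRank (E ⊗ P ⊖ idM n) r → r ≡ n ∸ p
rank-complement {n} {p} {r} P E PE≐1 rank@((s , ind) , _) =
  trans (sym (ℕ.m+n∸n≡m r p)) (cong (_∸ p) (ℕ.≤-antisym upper lower))
  where
  B : Matrix n n
  B = E ⊗ P ⊖ idM n

  PB≡0 : ∀ b j → (P ⊗ B) b j ≡ 0ℚ
  PB≡0 b j = begin
    Σ[< n ] (λ i → P b i * ((E ⊗ P) i j - idM n i j))
      ≡⟨ Σ-cong (λ i → ℚ.*-distribˡ-+ (P b i) _ _) ⟩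
    Σ[< n ] (λ i → P b i * (E ⊗ P) i j + P b i * - idM n i j)
      ≡⟨ Σ-distrib-+ (λ i → P b i * (E ⊗ P) i j) _ ⟩
    (P ⊗ (E ⊗ P)) b j + Σ[< n ] (λ i → P b i * - idM n i j)
      ≡⟨ cong₂ _+_ (trans (sym (⊗-assoc P E P b j))
                          (trans (⊗-cong PE≐1 (≐-refl {A = P}) b j) (⊗-identityˡ P b j)))
                   (trans (Σ-cong (λ i → sym (ℚ.neg-distribʳ-* (P b i) (idM n i j))))
                          (trans (sym (neg-distrib-Σ {n} _)) (cong -_ (⊗-identityʳ P b j)))) ⟩
    P b j - P b j
      ≡⟨ ℚ.+-inverseʳ (P b j) ⟩
    0ℚ ∎
    where open ≡-Reasoning

  upper : r ℕ.+ p ≤ n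
  upper = LinIndep⇒≤ (r ℕ.+ p) _
    (LinIndep-++ (λ l → col B (s l)) (col E) P ind (λ b l → PB≡0 b (s l)) PE≐1)

  lower : n ≤ r ℕ.+ p
  lower with HasRank⇒factorization B rank
  ... | C , D , B≐CD = LinIndep⇒≤ n _ (leftInverse⇒LinIndep F (col K) FK≐1)
    where
    F : Matrix n (r ℕ.+ p)
    F = (λ i l → - C i l) ∥ E

    K : Matrix (r ℕ.+ p) n
    K = D ++ P

    FK≐1 : F ⊗ K ≐ idM n
    FK≐1 i j = begin
      (F ⊗ K) i j
        ≡⟨ ∥-⊗-++ (λ i l → - C i l) E D P i j ⟩
      Σ[< r ] (λ l → - C i l * D l j) + (E ⊗ P) i j
        ≡⟨ cong (_+ (E ⊗ P) i j) (trans (Σ-cong (λ l → sym (ℚ.neg-distribˡ-* (C i l) (D l j))))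
                                        (trans (sym (neg-distrib-Σ {r} _)) (cong -_ (sym (B≐CD i j))))) ⟩
      - ((E ⊗ P) i j - idM n i j) + (E ⊗ P) i j
        ≡⟨ solve 2 (λ m e → :- (m :- e) :+ m := e) refl ((E ⊗ P) i j) (idM n i j) ⟩
      idM n i j ∎
      where open ≡-Reasoning

diagonal-⊗-comm : ∀ {n} (A B : Matrix n n) → IsDiagonal A → IsDiagonal B → A ⊗ B ≐ B ⊗ A
diagonal-⊗-comm A B A-diag B-diag i j =
  trans (diagonal-⊗ A B A-diag) (trans (by-cases (i ≟ j)) (sym (diagonal-⊗ B A B-diag)))
  where
  diagonal-⊗ : ∀ X Y → IsDiagonal X → (X ⊗ Y) i j ≡ X i i * Y i j
  diagonal-⊗ X Y X-diag = Σ-single (λ l → X i l * Y l j) i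
    (λ l l≢i → trans (cong (_* Y l j) (X-diag i l (l≢i ∘ sym))) (ℚ.*-zeroˡ (Y l j)))

  by-cases : Dec (i ≡ j) → A i i * B i j ≡ B i i * A i j
  by-cases (yes refl) = ℚ.*-comm (A i i) (B i i)
  by-cases (no i≢j)   = begin
    A i i * B i j ≡⟨ cong (A i i *_) (B-diag i j i≢j) ⟩
    A i i * 0ℚ    ≡⟨ solve 2 (λ a b → a :* con 0ℚ := b :* con 0ℚ) refl (A i i) (B i i) ⟩
    B i i * 0ℚ    ≡⟨ cong (B i i *_) (sym (A-diag i j i≢j)) ⟩
    B i i * A i j ∎
    where open ≡-Reasoning

sandwich : ∀ {n p r} (P : Matrix p n) (Q : Matrix n p) (W : Matrix p p) (C : Matrix n r) (D : Matrix r n) →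
  (Q ⊗ W) ⊗ P ⊖ idM n ≐ C ⊗ D → ∀ X Y →
  (P ⊗ X ⊗ Q) ⊗ W ⊗ (P ⊗ Y ⊗ Q) ≐ (P ⊗ X ⊗ C) ⊗ (D ⊗ (Y ⊗ Q)) ⊕ (P ⊗ X) ⊗ (Y ⊗ Q)
sandwich {n} P Q W C D B≐CD X Y = begin
  ((A ⊗ Q) ⊗ W) ⊗ ((P ⊗ Y) ⊗ Q)   ≈⟨ ⊗-cong (⊗-assoc A Q W) (⊗-assoc P Y Q) ⟩
  (A ⊗ (Q ⊗ W)) ⊗ (P ⊗ Z)         ≈⟨ ⊗-assoc A (Q ⊗ W) (P ⊗ Z) ⟩
  A ⊗ ((Q ⊗ W) ⊗ (P ⊗ Z))         ≈⟨ ⊗-congˡ A (⊗-assoc (Q ⊗ W) P Z) ⟨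
  A ⊗ (((Q ⊗ W) ⊗ P) ⊗ Z)         ≈⟨ ⊗-congˡ A (⊗-cong QWP≐CD+1 (≐-refl {A = Z})) ⟩
  A ⊗ ((C ⊗ D ⊕ idM n) ⊗ Z)       ≈⟨ ⊗-congˡ A (⊗-distribʳ-⊕ (C ⊗ D) (idM n) Z) ⟩
  A ⊗ ((C ⊗ D) ⊗ Z ⊕ idM n ⊗ Z)   ≈⟨ ⊗-congˡ A (⊕-cong (⊗-assoc C D Z) (⊗-identityˡ Z)) ⟩
  A ⊗ (C ⊗ (D ⊗ Z) ⊕ Z)           ≈⟨ ⊗-distribˡ-⊕ A (C ⊗ (D ⊗ Z)) Z ⟩
  A ⊗ (C ⊗ (D ⊗ Z)) ⊕ A ⊗ Z       ≈⟨ ⊕-cong (⊗-assoc A C (D ⊗ Z)) (≐-refl {A = A ⊗ Z}) ⟨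
  A ⊗ C ⊗ (D ⊗ Z) ⊕ A ⊗ Z         ∎
  where
  open ≐-Reasoning

  A : Matrix _ n
  A = P ⊗ X

  Z : Matrix n _
  Z = Y ⊗ Q

  QWP≐CD+1 : (Q ⊗ W) ⊗ P ≐ C ⊗ D ⊕ idM n
  QWP≐CD+1 i j = trans (solve 2 (λ m e → m := (m :- e) :+ e) refl (((Q ⊗ W) ⊗ P) i j) (idM n i j))
                       (cong (_+ idM n i j) (B≐CD i j))

⊗-comm-inner : ∀ {m n k} (P : Matrix m n) (Q : Matrix n k) (X Y : Matrix n n) → X ⊗ Y ≐ Y ⊗ X →
  (P ⊗ X) ⊗ (Y ⊗ Q) ≐ (P ⊗ Y) ⊗ (X ⊗ Q)
⊗-comm-inner P Q X Y XY≐YX = begin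
  (P ⊗ X) ⊗ (Y ⊗ Q)   ≈⟨ ⊗-assoc P X (Y ⊗ Q) ⟩
  P ⊗ (X ⊗ (Y ⊗ Q))   ≈⟨ ⊗-congˡ P (⊗-assoc X Y Q) ⟨
  P ⊗ ((X ⊗ Y) ⊗ Q)   ≈⟨ ⊗-congˡ P (⊗-cong XY≐YX (≐-refl {A = Q})) ⟩
  P ⊗ ((Y ⊗ X) ⊗ Q)   ≈⟨ ⊗-congˡ P (⊗-assoc Y X Q) ⟩
  P ⊗ (Y ⊗ (X ⊗ Q))   ≈⟨ ⊗-assoc P Y (X ⊗ Q) ⟨
  (P ⊗ Y) ⊗ (X ⊗ Q)   ∎
  where open ≐-Reasoning

commutator-factorization : ∀ {n p r} (P : Matrix p n) (Q : Matrix n p) (W : Matrix p p)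
  (C : Matrix n r) (D : Matrix r n) → (Q ⊗ W) ⊗ P ⊖ idM n ≐ C ⊗ D →
  ∀ X Y → X ⊗ Y ≐ Y ⊗ X →
  ((P ⊗ X ⊗ Q) ⊗ W ⊗ (P ⊗ Y ⊗ Q)) ⊖ ((P ⊗ Y ⊗ Q) ⊗ W ⊗ (P ⊗ X ⊗ Q))
    ≐ (P ⊗ X ⊗ C) ⊗ (D ⊗ (Y ⊗ Q)) ⊖ (P ⊗ Y ⊗ C) ⊗ (D ⊗ (X ⊗ Q))
commutator-factorization P Q W C D B≐CD X Y XY≐YX i j =
  trans (cong₂ _-_ (sandwich P Q W C D B≐CD X Y i j) (sandwich P Q W C D B≐CD Y X i j))
        (trans (cong (λ t → (a + s) - (b + t)) (sym (⊗-comm-inner P Q X Y XY≐YX i j)))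
               (solve 3 (λ a b s → (a :+ s) :- (b :+ s) := a :- b) refl a b s))
  where
  a b s : ℚ
  a = ((P ⊗ X ⊗ C) ⊗ (D ⊗ (Y ⊗ Q))) i j
  b = ((P ⊗ Y ⊗ C) ⊗ (D ⊗ (X ⊗ Q))) i j
  s = ((P ⊗ X) ⊗ (Y ⊗ Q)) i j

lemma4p1 : (n t p : ℕ) → 2 ≤ n → 2 ≤ t → 2 ≤ p → p < n →
    (P : Matrix p n) (Q : Matrix n p) → HasRank P p → HasRank Q p →
    HasRank (P ⊗ Q) p →
    (W0inv : Matrix p p) → (P ⊗ Q) ⊗ W0inv ≐ idM p → W0inv ⊗ (P ⊗ Q) ≐ idM p →
    (U : Fin t → Matrix n n) → (∀ a → IsDiagonal (U a)) →
    (r : ℕ) → HasRank ((Q ⊗ W0inv) ⊗ P ⊖ idM n) r →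
    (r ≡ n ∸ p) ×
    (Σ (Fin t → Matrix p r) λ V → Σ (Fin t → Matrix r p) λ G →
      ∀ (a b : Fin t) → a Data.Fin.< b →
        ((P ⊗ U a ⊗ Q) ⊗ W0inv ⊗ (P ⊗ U b ⊗ Q)) ⊖ ((P ⊗ U b ⊗ Q) ⊗ W0inv ⊗ (P ⊗ U a ⊗ Q))
          ≐ (V a ⊗ G b) ⊖ (V b ⊗ G a))
lemma4p1 n t p _ _ _ _ P Q _ _ _ W PQ⊗W≐1 _ U U-diagonal r rank-B
  with HasRank⇒factorization ((Q ⊗ W) ⊗ P ⊖ idM n) rank-B
... | C , D , B≐CD =
  rank-complement P (Q ⊗ W) P⊗QW≐1 rank-B ,
  (λ a → P ⊗ U a ⊗ C) , (λ b → D ⊗ (U b ⊗ Q)) ,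
  λ a b _ → commutator-factorization P Q W C D B≐CD (U a) (U b)
              (diagonal-⊗-comm (U a) (U b) (U-diagonal a) (U-diagonal b))
  where
  P⊗QW≐1 : P ⊗ (Q ⊗ W) ≐ idM p
  P⊗QW≐1 i j = trans (sym (⊗-assoc P Q W i j)) (PQ⊗W≐1 i j)
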